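{- Let $k$ and $r$ be positive integers with $k\geq 2$ and $1\leq r<k-1$, let $D$ be the diameter of $K(2k+r,k)$, and let $p\geq 1$ be an integer with $2p+1<D$. Let $A$ and $B$ be vertices of $K_{=2p+1}(2k+r,k)$ with $s=|A\cap B|\geq rp+1$. Then the distance between $A$ and $B$ in $K_{=2p+1}(2k+r,k)$ equals \[\min\left\{1+2\left\lceil\frac{s-rp}{2rp+r}\right\rceil,\ 2\left\lceil\frac{k-s}{2rp+r}\right\rceil\right\}.\]
   Context: For positive integers $n,k$, $[n]^k$ is the set of $k$-element subsets of $\{1,\dots,n\}$. The Kneser graph $K(2k+r,k)$ has vertex set $[2k+r]^k$, with $A,B$ adjacent iff $A\cap B=\emptyset$; it is connected. For a connected graph $G$ and positive integer $d$, the exact distance-$d$ graph $G_{=d}$ has the same vertex set as $G$, with two vertices adjacent iff their distance in $G$ is exactly $d$. $K_{=d}(2k+r,k)$ denotes the exact distance-$d$ graph of $K(2k+r,k)$. (The diameter of $K(2k+r,k)$ is $\lceil (k-1)/r\rceil+1$.) -}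

module Defs where

open import Data.Nat using (ℕ; zero; suc; _+_; _*_; _∸_; _≤_; _<_; NonZero)
open import Data.Nat.DivMod using (_/_)
open import Data.Fin.Subset using (Subset; ⊥; _∩_; ∣_∣)
open import Data.Product using (Σ; _×_; _,_; proj₁; ∃)
open import Relation.Binary.PropositionalEquality using (_≡_)

data Walk {V : Set} (Adj : V → V → Set) : V → V → ℕ → Set where
  here : ∀ {x} → Walk Adj x x zero
  step : ∀ {x y z m} → Adj x y → Walk Adj y z m → Walk Adj x z (suc m)

IsDist : {V : Set} → (V → V → Set) → V → V → ℕ → Set
IsDist Adj x y d = Walk Adj x y d × (∀ m → Walk Adj x y m → d ≤ m)

IsDiameter : {V : Set} → (V → V → Set) → ℕ → Set
IsDiameter {V} Adj D =
  (∀ x y → Σ ℕ λ d → IsDist Adj x y d × d ≤ D)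
  × Σ V (λ x → Σ V λ y → IsDist Adj x y D)

KVertex : ℕ → ℕ → Set
KVertex n k = Σ (Subset n) (λ A → ∣ A ∣ ≡ k)

KAdj : (n k : ℕ) → KVertex n k → KVertex n k → Set
KAdj n k A B = proj₁ A ∩ proj₁ B ≡ ⊥

ExactAdj : {V : Set} → (V → V → Set) → ℕ → V → V → Set
ExactAdj Adj d x y = IsDist Adj x y d

KExactAdj : (n k d : ℕ) → KVertex n k → KVertex n k → Set
KExactAdj n k d = ExactAdj (KAdj n k) d

ceilDiv : ℕ → (b : ℕ) → .{{NonZero b}} → ℕ
ceilDiv a b = (a + (b ∸ 1)) / b

min : ℕ → ℕ → ℕ
min = Data.Nat._⊓_

-- Write i = |A ∩ B| and j = |A ∖ B| = k − i. Counting in the Venn diagram of three k-subsets of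
-- [2k+r] gives |A ∖ C| ≤ |A ∩ B| + |B ∩ C| + r, |A ∖ C| ≤ |A ∖ B| + |B ∖ C| and
-- |A ∩ C| ≤ |A ∖ B| + |B ∩ C|. Hence in any graph on k-sets whose adjacent vertices meet in at
-- most e elements, a walk of length 2m forces j ≤ m(2e+r) and one of length 2m+1 forces
-- i ≤ e + m(2e+r). Conversely, if 2e ≤ k and any two k-sets meeting in exactly e elements are
-- adjacent, such walks exist: their vertices are k-sets with prescribed intersections with the
-- endpoints. The Kneser graph is the case e = 0, and from it one reads off that K_{=2p+1} is the
-- case e = rp as soon as 2rp < k, which D > 2p+1 guarantees. Minimising over both parities gives
-- the formula.
module Submission where

open import Defs
open import Data.Nat using (ℕ; zero; suc; _+_; _*_; _∸_; _≤_; _<_; z≤n; s≤s; s≤s⁻¹; NonZero; >-nonZero; _⊓_; _≤?_; _<?_)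
open import Data.Nat.Properties
open import Data.Nat.DivMod using (_%_; m≡m%n+[m/n]*n; m%n<n; m<n*o⇒m/o<n)
open import Data.Nat.Tactic.RingSolver using (solve-∀)
open import Data.Bool using (true; false; _∧_; _∨_; not; T)
open import Data.Unit using (tt)
open import Data.Vec using ([]; _∷_)
open import Data.Fin.Subset using (Subset; ⊥; ∁; _∩_; _∪_; ∣_∣)
open import Data.Fin.Subset.Properties using (∩-comm; ∣p∣≤∣x∷p∣; ∣⊥∣≡0; ∣∁p∣≡n∸∣p∣)
open import Data.Product using (∃-syntax; _×_; _,_; proj₁)
open import Data.Sum using (inj₁; inj₂)
open import Data.Empty using (⊥-elim)
open import Relation.Nullary using (yes; no)
open import Relation.Binary.PropositionalEquality

private
  variable
    n : ℕ

∣p∣≡0⇒p≡⊥ : (p : Subset n) → ∣ p ∣ ≡ 0 → p ≡ ⊥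
∣p∣≡0⇒p≡⊥ []          _  = refl
∣p∣≡0⇒p≡⊥ (false ∷ p) eq = cong (false ∷_) (∣p∣≡0⇒p≡⊥ p eq)

∣p∩∁p∣≡0 : (p : Subset n) → ∣ p ∩ ∁ p ∣ ≡ 0
∣p∩∁p∣≡0 []          = refl
∣p∩∁p∣≡0 (true ∷ p)  = ∣p∩∁p∣≡0 p
∣p∩∁p∣≡0 (false ∷ p) = ∣p∩∁p∣≡0 p

∣p∩∁q∣≡0⇒∣q∩∁p∣≡0⇒p≡q : (p q : Subset n) → ∣ p ∩ ∁ q ∣ ≡ 0 → ∣ q ∩ ∁ p ∣ ≡ 0 → p ≡ q
∣p∩∁q∣≡0⇒∣q∩∁p∣≡0⇒p≡q []          []          _   _   = refl
∣p∩∁q∣≡0⇒∣q∩∁p∣≡0⇒p≡q (true ∷ p)  (true ∷ q)  p⊆q q⊆p = cong (true ∷_) (∣p∩∁q∣≡0⇒∣q∩∁p∣≡0⇒p≡q p q p⊆q q⊆p)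
∣p∩∁q∣≡0⇒∣q∩∁p∣≡0⇒p≡q (false ∷ p) (false ∷ q) p⊆q q⊆p = cong (false ∷_) (∣p∩∁q∣≡0⇒∣q∩∁p∣≡0⇒p≡q p q p⊆q q⊆p)

∣p∩q∣+∣p∩∁q∣≡∣p∣ : (p q : Subset n) → ∣ p ∩ q ∣ + ∣ p ∩ ∁ q ∣ ≡ ∣ p ∣
∣p∩q∣+∣p∩∁q∣≡∣p∣ []          []          = refl
∣p∩q∣+∣p∩∁q∣≡∣p∣ (true ∷ p)  (true ∷ q)  = cong suc (∣p∩q∣+∣p∩∁q∣≡∣p∣ p q)
∣p∩q∣+∣p∩∁q∣≡∣p∣ (true ∷ p)  (false ∷ q) = trans (+-suc _ _) (cong suc (∣p∩q∣+∣p∩∁q∣≡∣p∣ p q))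
∣p∩q∣+∣p∩∁q∣≡∣p∣ (false ∷ p) (_ ∷ q)     = ∣p∩q∣+∣p∩∁q∣≡∣p∣ p q

∣p∪q∣+∣p∩q∣≡∣p∣+∣q∣ : (p q : Subset n) → ∣ p ∪ q ∣ + ∣ p ∩ q ∣ ≡ ∣ p ∣ + ∣ q ∣
∣p∪q∣+∣p∩q∣≡∣p∣+∣q∣ []          []          = refl
∣p∪q∣+∣p∩q∣≡∣p∣+∣q∣ (true ∷ p)  (true ∷ q)  =
  cong suc (trans (+-suc _ _) (trans (cong suc (∣p∪q∣+∣p∩q∣≡∣p∣+∣q∣ p q)) (sym (+-suc _ _))))
∣p∪q∣+∣p∩q∣≡∣p∣+∣q∣ (true ∷ p)  (false ∷ q) = cong suc (∣p∪q∣+∣p∩q∣≡∣p∣+∣q∣ p q)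
∣p∪q∣+∣p∩q∣≡∣p∣+∣q∣ (false ∷ p) (true ∷ q)  = trans (cong suc (∣p∪q∣+∣p∩q∣≡∣p∣+∣q∣ p q)) (sym (+-suc _ _))
∣p∪q∣+∣p∩q∣≡∣p∣+∣q∣ (false ∷ p) (false ∷ q) = ∣p∪q∣+∣p∩q∣≡∣p∣+∣q∣ p q

∣a∷p∣≤∣b∷q∣+∣c∷r∣ : ∀ a b c (p q r : Subset n) → (T a → T (b ∨ c)) →
  ∣ p ∣ ≤ ∣ q ∣ + ∣ r ∣ → ∣ a ∷ p ∣ ≤ ∣ b ∷ q ∣ + ∣ c ∷ r ∣
∣a∷p∣≤∣b∷q∣+∣c∷r∣ false b c _ q r _ le =
  ≤-trans le (+-mono-≤ (∣p∣≤∣x∷p∣ b q) (∣p∣≤∣x∷p∣ c r))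
∣a∷p∣≤∣b∷q∣+∣c∷r∣ true true c _ q r _ le =
  s≤s (≤-trans le (+-monoʳ-≤ ∣ q ∣ (∣p∣≤∣x∷p∣ c r)))
∣a∷p∣≤∣b∷q∣+∣c∷r∣ true false true  _ _ _ _ le = ≤-trans (s≤s le) (≤-reflexive (sym (+-suc _ _)))
∣a∷p∣≤∣b∷q∣+∣c∷r∣ true false false _ _ _ a⇒b∨c _ = ⊥-elim (a⇒b∨c tt)

∣p∩∁r∣≤∣p∩∁q∣+∣q∩∁r∣ : (p q r : Subset n) → ∣ p ∩ ∁ r ∣ ≤ ∣ p ∩ ∁ q ∣ + ∣ q ∩ ∁ r ∣
∣p∩∁r∣≤∣p∩∁q∣+∣q∩∁r∣ []      []      []      = z≤n
∣p∩∁r∣≤∣p∩∁q∣+∣q∩∁r∣ (x ∷ p) (y ∷ q) (z ∷ r) =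
  ∣a∷p∣≤∣b∷q∣+∣c∷r∣ (x ∧ not z) (x ∧ not y) (y ∧ not z) (p ∩ ∁ r) (p ∩ ∁ q) (q ∩ ∁ r) (pointwise x y z)
    (∣p∩∁r∣≤∣p∩∁q∣+∣q∩∁r∣ p q r)
  where
  pointwise : ∀ x y z → T (x ∧ not z) → T (x ∧ not y ∨ y ∧ not z)
  pointwise true false _     _ = tt
  pointwise true true  false _ = tt

∣p∩r∣≤∣p∩∁q∣+∣q∩r∣ : (p q r : Subset n) → ∣ p ∩ r ∣ ≤ ∣ p ∩ ∁ q ∣ + ∣ q ∩ r ∣
∣p∩r∣≤∣p∩∁q∣+∣q∩r∣ []      []      []      = z≤n
∣p∩r∣≤∣p∩∁q∣+∣q∩r∣ (x ∷ p) (y ∷ q) (z ∷ r) =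
  ∣a∷p∣≤∣b∷q∣+∣c∷r∣ (x ∧ z) (x ∧ not y) (y ∧ z) (p ∩ r) (p ∩ ∁ q) (q ∩ r) (pointwise x y z)
    (∣p∩r∣≤∣p∩∁q∣+∣q∩r∣ p q r)
  where
  pointwise : ∀ x y z → T (x ∧ z) → T (x ∧ not y ∨ y ∧ z)
  pointwise true false true _ = tt
  pointwise true true  true _ = tt

∣p∩∁r∣≤∣p∩q∣+∣∁[q∪r]∣ : (p q r : Subset n) → ∣ p ∩ ∁ r ∣ ≤ ∣ p ∩ q ∣ + ∣ ∁ (q ∪ r) ∣
∣p∩∁r∣≤∣p∩q∣+∣∁[q∪r]∣ []      []      []      = z≤n
∣p∩∁r∣≤∣p∩q∣+∣∁[q∪r]∣ (x ∷ p) (y ∷ q) (z ∷ r) =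
  ∣a∷p∣≤∣b∷q∣+∣c∷r∣ (x ∧ not z) (x ∧ y) (not (y ∨ z)) (p ∩ ∁ r) (p ∩ q) (∁ (q ∪ r)) (pointwise x y z)
    (∣p∩∁r∣≤∣p∩q∣+∣∁[q∪r]∣ p q r)
  where
  pointwise : ∀ x y z → T (x ∧ not z) → T (x ∧ y ∨ not (y ∨ z))
  pointwise true true  false _ = tt
  pointwise true false false _ = tt

subset-with-overlaps : (p q : Subset n) {a b c d : ℕ} →
  a ≤ ∣ p ∩ q ∣ → b ≤ ∣ p ∩ ∁ q ∣ → c ≤ ∣ q ∩ ∁ p ∣ → d ≤ ∣ ∁ (p ∪ q) ∣ →
  ∃[ s ] ∣ s ∣ ≡ (a + b) + (c + d) × ∣ p ∩ s ∣ ≡ a + b × ∣ s ∩ q ∣ ≡ a + c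
subset-with-overlaps [] [] z≤n z≤n z≤n z≤n = [] , refl , refl , refl
subset-with-overlaps (true ∷ p) (true ∷ q) z≤n hb hc hd =
  let s , ∣s∣ , ∣p∩s∣ , ∣s∩q∣ = subset-with-overlaps p q z≤n hb hc hd
  in false ∷ s , ∣s∣ , ∣p∩s∣ , ∣s∩q∣
subset-with-overlaps (true ∷ p) (true ∷ q) (s≤s ha) hb hc hd =
  let s , ∣s∣ , ∣p∩s∣ , ∣s∩q∣ = subset-with-overlaps p q ha hb hc hd
  in true ∷ s , cong suc ∣s∣ , cong suc ∣p∩s∣ , cong suc ∣s∩q∣
subset-with-overlaps (true ∷ p) (false ∷ q) ha z≤n hc hd =
  let s , ∣s∣ , ∣p∩s∣ , ∣s∩q∣ = subset-with-overlaps p q ha z≤n hc hd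
  in false ∷ s , ∣s∣ , ∣p∩s∣ , ∣s∩q∣
subset-with-overlaps (true ∷ p) (false ∷ q) {a} {suc b} {c} {d} ha (s≤s hb) hc hd =
  let s , ∣s∣ , ∣p∩s∣ , ∣s∩q∣ = subset-with-overlaps p q ha hb hc hd
  in true ∷ s , trans (cong suc ∣s∣) (cong (_+ (c + d)) (sym (+-suc a b))) ,
     trans (cong suc ∣p∩s∣) (sym (+-suc a b)) , ∣s∩q∣
subset-with-overlaps (false ∷ p) (true ∷ q) ha hb z≤n hd =
  let s , ∣s∣ , ∣p∩s∣ , ∣s∩q∣ = subset-with-overlaps p q ha hb z≤n hd
  in false ∷ s , ∣s∣ , ∣p∩s∣ , ∣s∩q∣
subset-with-overlaps (false ∷ p) (true ∷ q) {a} {b} {suc c} {d} ha hb (s≤s hc) hd =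
  let s , ∣s∣ , ∣p∩s∣ , ∣s∩q∣ = subset-with-overlaps p q ha hb hc hd
  in true ∷ s , trans (cong suc ∣s∣) (sym (+-suc (a + b) (c + d))) ,
     ∣p∩s∣ , trans (cong suc ∣s∩q∣) (sym (+-suc a c))
subset-with-overlaps (false ∷ p) (false ∷ q) ha hb hc z≤n =
  let s , ∣s∣ , ∣p∩s∣ , ∣s∩q∣ = subset-with-overlaps p q ha hb hc z≤n
  in false ∷ s , ∣s∣ , ∣p∩s∣ , ∣s∩q∣
subset-with-overlaps (false ∷ p) (false ∷ q) {a} {b} {c} {suc d} ha hb hc (s≤s hd) =
  let s , ∣s∣ , ∣p∩s∣ , ∣s∩q∣ = subset-with-overlaps p q ha hb hc hd
  in true ∷ s , trans (cong suc ∣s∣) (sym (trans (cong (a + b +_) (+-suc c d)) (+-suc (a + b) (c + d)))) ,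
     ∣p∩s∣ , ∣s∩q∣

data EvenOrOdd : ℕ → Set where
  even : ∀ m → EvenOrOdd (2 * m)
  odd  : ∀ m → EvenOrOdd (suc (2 * m))

even-or-odd : ∀ n → EvenOrOdd n
even-or-odd zero = even 0
even-or-odd (suc n) with even-or-odd n
... | even m = odd m
... | odd m  = subst EvenOrOdd (*-suc 2 m) (even (suc m))

m≤⌈m/n⌉*n : ∀ m n .{{_ : NonZero n}} → m ≤ ceilDiv m n * n
m≤⌈m/n⌉*n m n = +-cancelʳ-≤ (n ∸ 1) m _ (begin
  m + (n ∸ 1)                ≡⟨ m≡m%n+[m/n]*n (m + (n ∸ 1)) n ⟩
  (m + (n ∸ 1)) % n + q * n  ≤⟨ +-monoˡ-≤ (q * n) (<⇒≤pred (m%n<n (m + (n ∸ 1)) n)) ⟩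
  (n ∸ 1) + q * n            ≡⟨ +-comm (n ∸ 1) (q * n) ⟩
  q * n + (n ∸ 1)            ∎)
  where
  open ≤-Reasoning
  q : ℕ
  q = ceilDiv m n

m≤o*n⇒⌈m/n⌉≤o : ∀ m n o .{{_ : NonZero n}} → m ≤ o * n → ceilDiv m n ≤ o
m≤o*n⇒⌈m/n⌉≤o m n o m≤o*n = s≤s⁻¹ (m<n*o⇒m/o<n (begin-strict
  m + (n ∸ 1)      ≤⟨ +-monoˡ-≤ (n ∸ 1) m≤o*n ⟩
  o * n + (n ∸ 1)  <⟨ +-monoʳ-< (o * n) (≤-reflexive (suc-pred n)) ⟩
  o * n + n        ≡⟨ +-comm (o * n) n ⟩
  suc o * n        ∎))
  where open ≤-Reasoning

module Kneser (k r : ℕ) where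

  Vertex : Set
  Vertex = KVertex (2 * k + r) k

  common : Vertex → Vertex → ℕ
  common A B = ∣ proj₁ A ∩ proj₁ B ∣

  missing : Vertex → Vertex → ℕ
  missing A B = ∣ proj₁ A ∩ ∁ (proj₁ B) ∣

  common+missing≡k : ∀ A B → common A B + missing A B ≡ k
  common+missing≡k (p , ∣p∣≡k) (q , _) = trans (∣p∩q∣+∣p∩∁q∣≡∣p∣ p q) ∣p∣≡k

  missing≡k∸common : ∀ A B → missing A B ≡ k ∸ common A B
  missing≡k∸common A B = sym (trans (cong (_∸ common A B) (sym (common+missing≡k A B)))
    (m+n∸m≡n (common A B) (missing A B)))

  missing-via-common : ∀ A B {m} → common A B + m ≡ k → missing A B ≡ m
  missing-via-common A B eq = +-cancelˡ-≡ (common A B) _ _ (trans (common+missing≡k A B) (sym eq))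

  common-comm : ∀ A B → common A B ≡ common B A
  common-comm (p , _) (q , _) = cong ∣_∣ (∩-comm p q)

  missing-comm : ∀ A B → missing A B ≡ missing B A
  missing-comm A B = missing-via-common A B (trans (cong (_+ missing B A) (common-comm A B)) (common+missing≡k B A))

  missing≡0⇒≡ : ∀ {A B} → missing A B ≡ 0 → A ≡ B
  missing≡0⇒≡ {p , ∣p∣≡k} {q , ∣q∣≡k} eq
    with refl ← ∣p∩∁q∣≡0⇒∣q∩∁p∣≡0⇒p≡q p q eq (trans (sym (missing-comm (p , ∣p∣≡k) (q , ∣q∣≡k))) eq)
    = cong (p ,_) (≡-irrelevant ∣p∣≡k ∣q∣≡k)

  ∣∁[A∪B]∣≡r+common : ∀ A B → ∣ ∁ (proj₁ A ∪ proj₁ B) ∣ ≡ r + common A B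
  ∣∁[A∪B]∣≡r+common A@(p , ∣p∣≡k) B@(q , ∣q∣≡k) = begin
    ∣ ∁ (p ∪ q) ∣                        ≡⟨ ∣∁p∣≡n∸∣p∣ (p ∪ q) ⟩
    2 * k + r ∸ ∣ p ∪ q ∣                ≡⟨ cong (_∸ ∣ p ∪ q ∣) 2k+r≡∣p∪q∣+[r+i] ⟩
    ∣ p ∪ q ∣ + (r + i) ∸ ∣ p ∪ q ∣      ≡⟨ m+n∸m≡n ∣ p ∪ q ∣ (r + i) ⟩
    r + i                                ∎
    where
    open ≡-Reasoning
    i : ℕ
    i = common A B
    2k+r≡∣p∪q∣+[r+i] : 2 * k + r ≡ ∣ p ∪ q ∣ + (r + i)
    2k+r≡∣p∪q∣+[r+i] = begin
      2 * k + r             ≡⟨ cong (λ x → k + x + r) (+-identityʳ k) ⟩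
      (k + k) + r           ≡⟨ cong (_+ r) (sym (trans (∣p∪q∣+∣p∩q∣≡∣p∣+∣q∣ p q) (cong₂ _+_ ∣p∣≡k ∣q∣≡k))) ⟩
      (∣ p ∪ q ∣ + i) + r   ≡⟨ +-assoc ∣ p ∪ q ∣ i r ⟩
      ∣ p ∪ q ∣ + (i + r)   ≡⟨ cong (∣ p ∪ q ∣ +_) (+-comm i r) ⟩
      ∣ p ∪ q ∣ + (r + i)   ∎

  missing-triangle : ∀ A B C → missing A C ≤ missing A B + missing B C
  missing-triangle (p , _) (q , _) (s , _) = ∣p∩∁r∣≤∣p∩∁q∣+∣q∩∁r∣ p q s

  common≤missing+common : ∀ A B C → common A C ≤ missing A B + common B C
  common≤missing+common (p , _) (q , _) (s , _) = ∣p∩r∣≤∣p∩∁q∣+∣q∩r∣ p q s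

  missing≤common+common+r : ∀ A B C → missing A C ≤ common A B + common B C + r
  missing≤common+common+r A B C = begin
    missing A C                          ≤⟨ ∣p∩∁r∣≤∣p∩q∣+∣∁[q∪r]∣ (proj₁ A) (proj₁ B) (proj₁ C) ⟩
    common A B + ∣ ∁ (proj₁ B ∪ proj₁ C) ∣ ≡⟨ cong (common A B +_) (∣∁[A∪B]∣≡r+common B C) ⟩
    common A B + (r + common B C)        ≡⟨ cong (common A B +_) (+-comm r (common B C)) ⟩
    common A B + (common B C + r)        ≡⟨ +-assoc (common A B) (common B C) r ⟨
    common A B + common B C + r          ∎
    where open ≤-Reasoning

  vertex-with-overlaps : ∀ A B {a b c d} →
    a ≤ common A B → b ≤ missing A B → c ≤ missing B A → d ≤ r + common A B →
    (a + b) + (c + d) ≡ k → ∃[ W ] common A W ≡ a + b × common W B ≡ a + c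
  vertex-with-overlaps A B ha hb hc hd sum =
    let s , ∣s∣ , ∣A∩s∣ , ∣s∩B∣ = subset-with-overlaps (proj₁ A) (proj₁ B) ha hb hc
                                    (subst (_ ≤_) (sym (∣∁[A∪B]∣≡r+common A B)) hd)
    in (s , trans ∣s∣ sum) , ∣A∩s∣ , ∣s∩B∣

  split-missing : ∀ A B {j j′} → j + j′ ≡ missing A B → ∃[ W ] missing A W ≡ j × missing W B ≡ j′
  split-missing A B {j} {j′} j+j′≡ =
    let W , ∣A∩W∣ , ∣W∩B∣ = vertex-with-overlaps A B {i} {j′} {j} {0} ≤-refl
                              (subst (j′ ≤_) j+j′≡ (m≤n+m j′ j))
                              (subst (j ≤_) (trans j+j′≡ (missing-comm A B)) (m≤m+n j j′))
                              z≤n (trans (rearrange₁ i j j′) i+[j+j′]≡k)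
    in W , missing-via-common A W (trans (cong (_+ j) ∣A∩W∣) (trans (rearrange₂ i j j′) i+[j+j′]≡k))
         , missing-via-common W B (trans (cong (_+ j′) ∣W∩B∣) (trans (+-assoc i j j′) i+[j+j′]≡k))
    where
    i : ℕ
    i = common A B
    i+[j+j′]≡k : i + (j + j′) ≡ k
    i+[j+j′]≡k = trans (cong (i +_) j+j′≡) (common+missing≡k A B)
    rearrange₁ : ∀ i j j′ → (i + j′) + (j + 0) ≡ i + (j + j′)
    rearrange₁ = solve-∀
    rearrange₂ : ∀ i j j′ → (i + j′) + j ≡ i + (j + j′)
    rearrange₂ = solve-∀

  split-common : ∀ A B {t u} → t + u ≡ common A B → ∃[ W ] common A W ≡ t × missing W B ≡ u
  split-common A B {t} {u} t+u≡ =
    let W , ∣A∩W∣ , ∣W∩B∣ = vertex-with-overlaps A B {t} {0} {j} {u}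
                              (subst (t ≤_) t+u≡ (m≤m+n t u)) z≤n (≤-reflexive (missing-comm A B))
                              (≤-trans (subst (u ≤_) t+u≡ (m≤n+m u t)) (m≤n+m (common A B) r))
                              (trans (rearrange₁ t u j) t+u+j≡k)
    in W , trans ∣A∩W∣ (+-identityʳ t)
         , missing-via-common W B (trans (cong (_+ u) ∣W∩B∣) (trans (rearrange₂ t u j) t+u+j≡k))
    where
    j : ℕ
    j = missing A B
    t+u+j≡k : (t + u) + j ≡ k
    t+u+j≡k = trans (cong (_+ j) t+u≡) (common+missing≡k A B)
    rearrange₁ : ∀ t u j → (t + 0) + (j + u) ≡ (t + u) + j
    rearrange₁ = solve-∀
    rearrange₂ : ∀ t u j → (t + j) + u ≡ (t + u) + j
    rearrange₂ = solve-∀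

  vertex-meeting-both : ∀ A B {e} → e + e ≤ k → missing A B ≤ e + e + r →
    ∃[ W ] common A W ≡ e × common W B ≡ e
  vertex-meeting-both A B {e} e+e≤k j≤e+e+r with ≤-total (missing A B) e
  ... | inj₁ j≤e =
    let W , ∣A∩W∣ , ∣W∩B∣ = vertex-with-overlaps A B {e ∸ j} {j} {j} {i ∸ e}
                              (≤-trans (m∸n≤m e j) e≤i) ≤-refl (≤-reflexive (missing-comm A B))
                              (≤-trans (m∸n≤m i e) (m≤n+m i r)) sum
    in W , trans ∣A∩W∣ (m∸n+n≡m j≤e) , trans ∣W∩B∣ (m∸n+n≡m j≤e)
    where
    i : ℕ
    i = common A B
    j : ℕ
    j = missing A B
    e≤i : e ≤ i
    e≤i = +-cancelʳ-≤ j e i (begin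
      e + j ≤⟨ +-monoʳ-≤ e j≤e ⟩
      e + e ≤⟨ e+e≤k ⟩
      k     ≡⟨ common+missing≡k A B ⟨
      i + j ∎)
      where open ≤-Reasoning
    sum : (e ∸ j + j) + (j + (i ∸ e)) ≡ k
    sum = begin
      (e ∸ j + j) + (j + (i ∸ e)) ≡⟨ cong (_+ (j + (i ∸ e))) (m∸n+n≡m j≤e) ⟩
      e + (j + (i ∸ e))           ≡⟨ swap e j (i ∸ e) ⟩
      j + (e + (i ∸ e))           ≡⟨ cong (j +_) (m+[n∸m]≡n e≤i) ⟩
      j + i                       ≡⟨ +-comm j i ⟩
      i + j                       ≡⟨ common+missing≡k A B ⟩
      k                           ∎
      where
      open ≡-Reasoning
      swap : ∀ x y z → x + (y + z) ≡ y + (x + z)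
      swap = solve-∀
  ... | inj₂ e≤j =
    vertex-with-overlaps A B {0} {e} {e} {k ∸ (e + e)}
      z≤n e≤j (subst (e ≤_) (missing-comm A B) e≤j) (m≤n+o⇒m∸n≤o k (e + e) k≤e+e+[r+i])
      (trans (sym (+-assoc e e (k ∸ (e + e)))) (m+[n∸m]≡n e+e≤k))
    where
    i : ℕ
    i = common A B
    k≤e+e+[r+i] : k ≤ (e + e) + (r + i)
    k≤e+e+[r+i] = begin
      k                 ≡⟨ common+missing≡k A B ⟨
      i + missing A B   ≤⟨ +-monoʳ-≤ i j≤e+e+r ⟩
      i + (e + e + r)   ≡⟨ rearrange i (e + e) r ⟩
      (e + e) + (r + i) ∎
      where
      open ≤-Reasoning
      rearrange : ∀ i x r → i + (x + r) ≡ x + (r + i)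
      rearrange = solve-∀

  module OverlapGraph (Adj : Vertex → Vertex → Set) (e : ℕ) where

    width : ℕ
    width = e + e + r

    module _ (adj⇒common≤e : ∀ A B → Adj A B → common A B ≤ e) where

      two-steps⇒missing≤width : ∀ {A W B} → Adj A W → Adj W B → missing A B ≤ width
      two-steps⇒missing≤width {A} {W} {B} AW WB = ≤-trans (missing≤common+common+r A W B)
        (+-monoˡ-≤ r (+-mono-≤ (adj⇒common≤e A W AW) (adj⇒common≤e W B WB)))

      even-walk⇒missing≤ : ∀ {A B} m → Walk Adj A B (2 * m) → missing A B ≤ m * width
      even-walk⇒missing≤ {A} zero here = ≤-reflexive (∣p∩∁p∣≡0 (proj₁ A))
      even-walk⇒missing≤ {A} {B} (suc m) w = peel (subst (Walk Adj A B) (*-suc 2 m) w)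
        where
        peel : Walk Adj A B (2 + 2 * m) → missing A B ≤ suc m * width
        peel (step AW₁ (step {y = W₂} W₁W₂ w′)) = ≤-trans (missing-triangle A W₂ B)
          (+-mono-≤ (two-steps⇒missing≤width AW₁ W₁W₂) (even-walk⇒missing≤ m w′))

      odd-walk⇒common≤ : ∀ {A B} m → Walk Adj A B (suc (2 * m)) → common A B ≤ e + m * width
      odd-walk⇒common≤ {A} {B} zero (step AB here) = ≤-trans (adj⇒common≤e A B AB) (m≤m+n e 0)
      odd-walk⇒common≤ {A} {B} (suc m) w = peel (subst (λ L → Walk Adj A B (suc L)) (*-suc 2 m) w)
        where
        open ≤-Reasoning
        swap : ∀ x y z → x + (y + z) ≡ y + (x + z)
        swap = solve-∀
        peel : Walk Adj A B (3 + 2 * m) → common A B ≤ e + suc m * width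
        peel (step AW₁ (step {y = W₂} W₁W₂ w′)) = begin
          common A B                  ≤⟨ common≤missing+common A W₂ B ⟩
          missing A W₂ + common W₂ B  ≤⟨ +-mono-≤ (two-steps⇒missing≤width AW₁ W₁W₂) (odd-walk⇒common≤ m w′) ⟩
          width + (e + m * width)     ≡⟨ swap width e (m * width) ⟩
          e + (width + m * width)     ∎

    module _ (e+e≤k : e + e ≤ k) (common≡e⇒adj : ∀ A B → common A B ≡ e → Adj A B) where

      missing≤width⇒two-steps : ∀ {A B} → missing A B ≤ width → ∃[ W ] Adj A W × Adj W B
      missing≤width⇒two-steps {A} {B} j≤width =
        let W , ∣A∩W∣ , ∣W∩B∣ = vertex-meeting-both A B e+e≤k j≤width
        in W , common≡e⇒adj A W ∣A∩W∣ , common≡e⇒adj W B ∣W∩B∣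

      missing≤⇒even-walk : ∀ {A B} m → missing A B ≤ m * width → Walk Adj A B (2 * m)
      missing≤⇒even-walk {A} {B} zero j≤0 with refl ← missing≡0⇒≡ {A} {B} (n≤0⇒n≡0 j≤0) = here
      missing≤⇒even-walk {A} {B} (suc m) j≤ =
        let W , missing[A,W]≡ , missing[W,B]≡ = split-missing A B (m⊓n+n∸m≡n width j)
            Z , AZ , ZW = missing≤width⇒two-steps {A} {W} (≤-trans (≤-reflexive missing[A,W]≡) (m⊓n≤m width j))
        in subst (Walk Adj A B) (sym (*-suc 2 m))
             (step AZ (step ZW (missing≤⇒even-walk {W} {B} m (subst (_≤ m * width) (sym missing[W,B]≡) rest≤))))
        where
        j : ℕ
        j = missing A B
        rest≤ : j ∸ width ≤ m * width
        rest≤ = ≤-trans (∸-monoˡ-≤ width j≤) (≤-reflexive (m+n∸m≡n width (m * width)))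

      common≤⇒odd-walk : ∀ {A B} m → e ≤ common A B → common A B ≤ e + m * width →
        Walk Adj A B (suc (2 * m))
      common≤⇒odd-walk {A} {B} m e≤i i≤ =
        let W , ∣A∩W∣ , missing[W,B]≡ = split-common A B (m+[n∸m]≡n e≤i)
        in step (common≡e⇒adj A W ∣A∩W∣) (missing≤⇒even-walk {W} {B} m
             (subst (_≤ m * width) (sym missing[W,B]≡) (m≤n+o⇒m∸n≤o (common A B) e i≤)))

    distance : (∀ A B → Adj A B → common A B ≤ e) →
      e + e ≤ k → (∀ A B → common A B ≡ e → Adj A B) →
      ∀ b .{{_ : NonZero b}} → b ≡ width → ∀ {A B} → e ≤ common A B →
      IsDist Adj A B (min (1 + 2 * ceilDiv (common A B ∸ e) b) (2 * ceilDiv (missing A B) b))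
    distance adj⇒common≤e e+e≤k common≡e⇒adj b b≡width {A} {B} e≤i = walk , shortest
      where
      u : ℕ
      u = common A B ∸ e
      j : ℕ
      j = missing A B
      odd-length : ℕ
      odd-length = 1 + 2 * ceilDiv u b
      even-length : ℕ
      even-length = 2 * ceilDiv j b
      in-width : ∀ m {x} → x ≤ m * b → x ≤ m * width
      in-width m {x} = subst (λ y → x ≤ m * y) b≡width
      in-b : ∀ m {x} → x ≤ m * width → x ≤ m * b
      in-b m {x} = subst (λ y → x ≤ m * y) (sym b≡width)
      odd-walk : Walk Adj A B odd-length
      odd-walk = common≤⇒odd-walk e+e≤k common≡e⇒adj (ceilDiv u b) e≤i (begin
        common A B                  ≡⟨ m+[n∸m]≡n e≤i ⟨
        e + u                       ≤⟨ +-monoʳ-≤ e (in-width (ceilDiv u b) (m≤⌈m/n⌉*n u b)) ⟩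
        e + ceilDiv u b * width     ∎)
        where open ≤-Reasoning
      even-walk : Walk Adj A B even-length
      even-walk = missing≤⇒even-walk e+e≤k common≡e⇒adj (ceilDiv j b) (in-width (ceilDiv j b) (m≤⌈m/n⌉*n j b))
      walk : Walk Adj A B (min odd-length even-length)
      walk with ⊓-sel odd-length even-length
      ... | inj₁ min≡odd  = subst (Walk Adj A B) (sym min≡odd) odd-walk
      ... | inj₂ min≡even = subst (Walk Adj A B) (sym min≡even) even-walk
      shortest : ∀ L → Walk Adj A B L → min odd-length even-length ≤ L
      shortest L w with even-or-odd L
      ... | even m = ≤-trans (m⊓n≤n odd-length even-length)
        (*-monoʳ-≤ 2 (m≤o*n⇒⌈m/n⌉≤o j b m (in-b m (even-walk⇒missing≤ adj⇒common≤e m w))))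
      ... | odd m = ≤-trans (m⊓n≤m odd-length even-length) (s≤s (*-monoʳ-≤ 2
        (m≤o*n⇒⌈m/n⌉≤o u b m (in-b m (m≤n+o⇒m∸n≤o (common A B) e (odd-walk⇒common≤ adj⇒common≤e m w))))))

  Kneser : Vertex → Vertex → Set
  Kneser = KAdj (2 * k + r) k

  kneser⇒common≤0 : ∀ A B → Kneser A B → common A B ≤ 0
  kneser⇒common≤0 _ _ A∩B≡⊥ = ≤-reflexive (trans (cong ∣_∣ A∩B≡⊥) (∣⊥∣≡0 (2 * k + r)))

  common≡0⇒kneser : ∀ A B → common A B ≡ 0 → Kneser A B
  common≡0⇒kneser A B = ∣p∣≡0⇒p≡⊥ (proj₁ A ∩ proj₁ B)

  module KneserWalks = OverlapGraph Kneser 0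

  kneser-odd-walk : ∀ {A B} m → common A B ≤ r * m → Walk Kneser A B (suc (2 * m))
  kneser-odd-walk {A} {B} m i≤rm =
    KneserWalks.common≤⇒odd-walk z≤n common≡0⇒kneser m z≤n (subst (common A B ≤_) (*-comm r m) i≤rm)

  kneser-even-walk : ∀ {A B} m → missing A B ≤ r * m → Walk Kneser A B (2 * m)
  kneser-even-walk {A} {B} m j≤rm =
    KneserWalks.missing≤⇒even-walk z≤n common≡0⇒kneser m (subst (missing A B ≤_) (*-comm r m) j≤rm)

  short-kneser-walk : ∀ p → k ≤ r * p + r * p → ∀ A B → ∃[ L ] L ≤ 2 * p + 1 × Walk Kneser A B L
  short-kneser-walk p k≤2rp A B with common A B ≤? r * p
  ... | yes i≤rp = suc (2 * p) , ≤-reflexive (+-comm 1 (2 * p)) , kneser-odd-walk p i≤rp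
  ... | no  i≰rp = 2 * p , m≤m+n (2 * p) 1 , kneser-even-walk p (+-cancelˡ-≤ (r * p) _ _ (begin
    r * p + missing A B       ≤⟨ +-monoˡ-≤ (missing A B) (<⇒≤ (≰⇒> i≰rp)) ⟩
    common A B + missing A B  ≡⟨ common+missing≡k A B ⟩
    k                         ≤⟨ k≤2rp ⟩
    r * p + r * p             ∎))
    where open ≤-Reasoning

  diameter>2p+1⇒2rp<k : ∀ p {D} → IsDiameter Kneser D → 2 * p + 1 < D → r * p + r * p < k
  diameter>2p+1⇒2rp<k p (_ , A , B , _ , shortest) 2p+1<D with r * p + r * p <? k
  ... | yes 2rp<k = 2rp<k
  ... | no  2rp≮k =
    let L , L≤2p+1 , w = short-kneser-walk p (≮⇒≥ 2rp≮k) A B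
    in ⊥-elim (<⇒≱ 2p+1<D (≤-trans (shortest L w) L≤2p+1))

  Exact : ℕ → Vertex → Vertex → Set
  Exact p = KExactAdj (2 * k + r) k (2 * p + 1)

  exact⇒common≤ : ∀ p A B → Exact p A B → common A B ≤ r * p
  exact⇒common≤ p A B (w , _) = subst (common A B ≤_) (*-comm p r)
    (KneserWalks.odd-walk⇒common≤ kneser⇒common≤0 p (subst (Walk Kneser A B) (+-comm (2 * p) 1) w))

  common≡⇒exact : ∀ p .{{_ : NonZero r}} → r * p + r * p < k → ∀ A B → common A B ≡ r * p → Exact p A B
  common≡⇒exact p 2rp<k A B i≡rp =
    subst (Walk Kneser A B) (+-comm 1 (2 * p)) (kneser-odd-walk p (≤-reflexive i≡rp)) , shortest
    where
    open ≤-Reasoning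
    rp<missing : r * p < missing A B
    rp<missing = +-cancelˡ-< (r * p) _ _ (begin-strict
      r * p + r * p             <⟨ 2rp<k ⟩
      k                         ≡⟨ common+missing≡k A B ⟨
      common A B + missing A B  ≡⟨ cong (_+ missing A B) i≡rp ⟩
      r * p + missing A B       ∎)
    shortest : ∀ L → Walk Kneser A B L → 2 * p + 1 ≤ L
    shortest L w with even-or-odd L
    ... | even m = begin
      2 * p + 1    ≡⟨ +-comm (2 * p) 1 ⟩
      suc (2 * p)  ≤⟨ n≤1+n _ ⟩
      2 + 2 * p    ≡⟨ *-suc 2 p ⟨
      2 * suc p    ≤⟨ *-monoʳ-≤ 2 p<m ⟩
      2 * m        ∎
      where
      p<m : p < m
      p<m = *-cancelʳ-< r p m (begin-strict
        p * r        ≡⟨ *-comm p r ⟩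
        r * p        <⟨ rp<missing ⟩
        missing A B  ≤⟨ KneserWalks.even-walk⇒missing≤ kneser⇒common≤0 m w ⟩
        m * r        ∎)
    ... | odd m = begin
      2 * p + 1        ≡⟨ +-comm (2 * p) 1 ⟩
      suc (2 * p)      ≤⟨ s≤s (*-monoʳ-≤ 2 (*-cancelʳ-≤ p m r (begin
        p * r          ≡⟨ *-comm p r ⟩
        r * p          ≡⟨ i≡rp ⟨
        common A B     ≤⟨ KneserWalks.odd-walk⇒common≤ kneser⇒common≤0 m w ⟩
        m * r          ∎))) ⟩
      suc (2 * m)      ∎

divisor≡width : ∀ r p .{{_ : NonZero r}} → suc (2 * r * p + r ∸ 1) ≡ r * p + r * p + r
divisor≡width (suc r) p = trans (cong (λ x → suc (x ∸ 1)) (+-suc (2 * suc r * p) r)) (rearrange r p)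
  where
  rearrange : ∀ r p → suc (2 * suc r * p + r) ≡ suc r * p + suc r * p + suc r
  rearrange = solve-∀

mainTheorem16 : (k r p D : ℕ) → 2 ≤ k → 1 ≤ r → r < k ∸ 1 →
    IsDiameter (KAdj (2 * k + r) k) D → 1 ≤ p → 2 * p + 1 < D →
    (A B : KVertex (2 * k + r) k) →
    r * p + 1 ≤ ∣ proj₁ A ∩ proj₁ B ∣ →
    IsDist (KExactAdj (2 * k + r) k (2 * p + 1)) A B
      (min (1 + 2 * ceilDiv (∣ proj₁ A ∩ proj₁ B ∣ ∸ r * p) (suc (2 * r * p + r ∸ 1)))
           (2 * ceilDiv (k ∸ ∣ proj₁ A ∩ proj₁ B ∣) (suc (2 * r * p + r ∸ 1))))
mainTheorem16 k r p D _ 1≤r _ diam _ 2p+1<D A B rp+1≤s =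
  subst (λ j → IsDist (Exact p) A B (min (1 + 2 * ceilDiv (common A B ∸ r * p) b) (2 * ceilDiv j b)))
    (missing≡k∸common A B)
    (Exact-p.distance (exact⇒common≤ p) (<⇒≤ 2rp<k) (common≡⇒exact p 2rp<k)
      b (divisor≡width r p) (≤-trans (m≤m+n (r * p) 1) rp+1≤s))
  where
  open Kneser k r
  instance
    r≢0 : NonZero r
    r≢0 = >-nonZero 1≤r
  b : ℕ
  b = suc (2 * r * p + r ∸ 1)
  2rp<k : r * p + r * p < k
  2rp<k = diameter>2p+1⇒2rp<k p diam 2p+1<D
  module Exact-p = OverlapGraph (Exact p) (r * p)
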